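{- Let $(V,w,d)$ be a weighted metric space, $X\subseteq V$ with $m=|X|$, and integers $k\le k'\le m$. Run the restricted reverse greedy algorithm with parameter $k'$ starting from $X$, and let $S_{k'}\subseteq S_{k'+1}\subseteq\dots\subseteq S_m=X$ be the successive sets it maintains, with $|S_i|=i$. Then for each $i\in[k'+1,m]$, $$\mathrm{cost}(S_{i-1})-\mathrm{cost}(S_i)\le \frac{2}{i-k}\cdot\mathrm{OPT}_k(V).$$
   Context: For $S\subseteq V$, $d(x,S)=\min_{y\in S}d(x,y)$ and $\mathrm{cost}(S)=\sum_{x\in V}w(x)d(x,S)$; $\mathrm{OPT}_k(V)=\min_{S\subseteq V,|S|=k}\mathrm{cost}(S)$. The restricted reverse greedy algorithm with parameter $k'$ initializes $S\leftarrow X$ and, while $|S|>k'$, removes from $S$ a point $y\in\arg\min_{z\in S}\mathrm{cost}(S\setminus\{z\})$ (ties broken arbitrarily); it returns $S$ once $|S|\le k'$. Thus $S_i$ denotes the set $S$ at the moment it has exactly $i$ points, and $S_{i-1}$ is obtained from $S_i$ by one removal step.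
   Formalization: The distances d and the weights w take rational values rather than real ones. -}

module Defs where

open import Data.Nat using (ℕ; zero; suc; _≡ᵇ_)
open import Data.Bool using (Bool; true; false; if_then_else_)
open import Data.Fin using (Fin)
open import Data.Fin.Subset using (Subset; inside; outside; ∣_∣)
open import Data.List using (List; []; _∷_; map; _++_; filter; foldr)
open import Data.Vec using (Vec; []; _∷_)
open import Data.Fin.Base using (zero; suc)
open import Data.Integer using (+_)
open import Data.Rational using (ℚ; 0ℚ; _+_; _*_; _⊓_; _≤_; _/_)
open import Relation.Binary.PropositionalEquality using (_≡_; _≢_)
open import Relation.Nullary using (¬_)

record IsMetric {n : ℕ} (d : Fin n → Fin n → ℚ) : Set where
  field
    nonneg   : ∀ x y → 0ℚ ≤ d x y
    zero-iff : ∀ x y → d x y ≡ 0ℚ → x ≡ y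
    refl0    : ∀ x → d x x ≡ 0ℚ
    symm     : ∀ x y → d x y ≡ d y x
    triangle : ∀ x y z → d x z ≤ d x y + d y z

elems : ∀ {n} → Subset n → List (Fin n)
elems {zero} [] = []
elems {suc n} (outside ∷ p) = map suc (elems p)
elems {suc n} (inside ∷ p) = zero ∷ map suc (elems p)

allSubsets : (n : ℕ) → List (Subset n)
allSubsets zero = [] ∷ []
allSubsets (suc n) = map (outside ∷_) (allSubsets n) ++ map (inside ∷_) (allSubsets n)

-- minimum of a list of rationals (junk value 0 on the empty list; never used below)
minList : List ℚ → ℚ
minList [] = 0ℚ
minList (q ∷ qs) = foldr _⊓_ q qs

sumList : List ℚ → ℚ
sumList = foldr _+_ 0ℚ

allPoints : (n : ℕ) → List (Fin n)
allPoints zero = []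
allPoints (suc n) = zero ∷ map suc (allPoints n)

distToSet : ∀ {n} → (Fin n → Fin n → ℚ) → Fin n → Subset n → ℚ
distToSet d x S = minList (map (d x) (elems S))

cost : ∀ {n} → (Fin n → Fin n → ℚ) → (Fin n → ℚ) → Subset n → ℚ
cost {n} d w S = sumList (map (λ x → w x * distToSet d x S) (allPoints n))

OPT : ∀ {n} → (Fin n → Fin n → ℚ) → (Fin n → ℚ) → ℕ → ℚ
OPT {n} d w k = minList (map (cost d w) (filterSize (allSubsets n)))
  where
  filterSize : List (Subset n) → List (Subset n)
  filterSize [] = []
  filterSize (S ∷ Ss) = if ∣ S ∣ ≡ᵇ k then S ∷ filterSize Ss else filterSize Ss

-- 2 / j as a rational (junk value 0 for j = 0; only used with j ≥ 1)
twoOver : ℕ → ℚ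
twoOver zero = 0ℚ
twoOver (suc j) = (+ 2) / suc j

{-# OPTIONS --safe #-}

-- Let T = S i, let y be the point removed from it, Δ = cost (T - y) - cost T, and let O be an
-- optimal k-set. Snap every centre of O to its nearest point of T; at least i - k points of T
-- are then unclaimed. By the greedy choice, Δ is at most the cost of removing any single
-- unclaimed point, so (i - k) Δ is at most the sum of these removal costs. In that sum a client
-- x pays only for the removal of its own nearest point c of T, and if c is unclaimed, x moves to
-- the snap of its optimal centre o at cost at most d(x,c) + 2 d(x,o). Summing over x gives
-- (i - k) Δ ≤ 2 OPT.

module Submission where

open import Defs
open import Data.Nat using (ℕ; _<_; _≤_; _∸_; pred)
open import Data.Fin using (Fin)
open import Data.Fin.Subset using (Subset; ∣_∣; _∈_; _-_)
open import Data.Product using (Σ; _×_)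
open import Data.Rational using (ℚ; 0ℚ; _*_) renaming (_≤_ to _≤ℚ_; _-_ to _-ℚ_)
open import Relation.Binary.PropositionalEquality using (_≡_)

open import Algebra.Definitions.RawMonoid Data.Rational.+-0-rawMonoid using () renaming (_×_ to _·_)
open import Data.Bool using (true; false; T)
open import Data.Empty using (⊥-elim)
open import Data.Fin using (zero; suc)
import Data.Fin.Properties as FinP
open import Data.Fin.Subset using (inside; outside; ⊥; _─_; _∪_; ⁅_⁆; ⋃; _∉_; _⊆_; Nonempty)
open import Data.Fin.Subset.Properties
  using (∣p∣≤n; _∈?_; p─⊥≡p; p─q⊆p; x∈p∧x∉q⇒x∈p─q; x∈p∧x≢y⇒x∈p-y; x∈p∪q⁺; x∈⁅x⁆; p⊆q⇒∣p∣≤∣q∣; ∣⁅x⁆∣≡1; ∣⊥∣≡0)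
open import Data.Integer using (+_)
import Data.Integer.Solver
open import Data.List using (List; []; _∷_; map; length)
open import Data.List.Membership.Propositional using () renaming (_∈_ to _∈ₗ_)
open import Data.List.Membership.Propositional.Properties using (∈-map⁺; ∈-map⁻; ∈-++⁺ˡ; ∈-++⁺ʳ; foldr-selective)
open import Data.List.Properties using (length-map; map-cong; foldr-preservesᵒ)
import Data.List.Relation.Unary.All as All
import Data.List.Relation.Unary.All.Properties as AllP
open import Data.List.Relation.Unary.Any as Any using (Any; here; there)
open import Data.List.Relation.Unary.AllPairs using ([]; _∷_)
open import Data.List.Relation.Unary.Unique.Propositional using (Unique)
import Data.List.Relation.Unary.Unique.Propositional.Properties as UniqueP
open import Data.Nat using (zero; suc; _≡ᵇ_; z≤n; s≤s; s≤s⁻¹) renaming (_+_ to _+ℕ_)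
import Data.Nat.Properties as ℕP
open import Data.Product as Product using (∃; _,_; proj₁; proj₂; map₂)
open import Data.Rational using (1ℚ; _+_; -_; _/_; toℚᵘ; nonNegative)
import Data.Rational.Properties as ℚP
import Data.Rational.Solver
open import Data.Rational.Unnormalised as ℚᵘ using (mkℚᵘ; *≡*) renaming (_≃_ to _≃ᵘ_)
import Data.Rational.Unnormalised.Properties as ℚᵘP
open import Data.Vec using ([]; _∷_; here; there)
open import Data.Sum using (_⊎_; inj₁; inj₂; [_,_])
open import Function using (_∘_)
open import Relation.Binary.Definitions using (DecidableEquality)
open import Relation.Binary.PropositionalEquality using (_≢_; refl; sym; trans; cong; cong₂; subst; subst₂)
open import Relation.Nullary using (yes; no)

private
  variable
    A : Set
    n : ℕ

2ℚ : ℚ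
2ℚ = + 2 / 1

p≤q⇒0≤q-p : ∀ {p q} → p ≤ℚ q → 0ℚ ≤ℚ q -ℚ p
p≤q⇒0≤q-p {p} {q} p≤q = subst (_≤ℚ q -ℚ p) (ℚP.+-inverseʳ p) (ℚP.+-monoˡ-≤ (- p) p≤q)

p≤q⇒p-q≤0 : ∀ {p q} → p ≤ℚ q → p -ℚ q ≤ℚ 0ℚ
p≤q⇒p-q≤0 {p} {q} p≤q = subst (p -ℚ q ≤ℚ_) (ℚP.+-inverseʳ q) (ℚP.+-monoˡ-≤ (- q) p≤q)

*-monoˡ-≤-≥0 : ∀ {r p q} → 0ℚ ≤ℚ r → p ≤ℚ q → r * p ≤ℚ r * q
*-monoˡ-≤-≥0 {r} 0≤r = ℚP.*-monoˡ-≤-nonNeg r {{nonNegative 0≤r}}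

*-nonNeg : ∀ {p q} → 0ℚ ≤ℚ p → 0ℚ ≤ℚ q → 0ℚ ≤ℚ p * q
*-nonNeg {p} {q} 0≤p 0≤q =
  ℚP.nonNegative⁻¹ (p * q) {{ℚP.nonNeg*nonNeg⇒nonNeg p {{nonNegative 0≤p}} q {{nonNegative 0≤q}}}}

·-nonNeg : ∀ m {p} → 0ℚ ≤ℚ p → 0ℚ ≤ℚ m · p
·-nonNeg zero    _   = ℚP.≤-refl
·-nonNeg (suc m) 0≤p = ℚP.+-mono-≤ 0≤p (·-nonNeg m 0≤p)

·-monoˡ-≤ : ∀ {m n p} → 0ℚ ≤ℚ p → m ≤ n → m · p ≤ℚ n · p
·-monoˡ-≤ {n = n} 0≤p z≤n       = ·-nonNeg n 0≤p
·-monoˡ-≤ {p = p} 0≤p (s≤s m≤n) = ℚP.+-monoʳ-≤ p (·-monoˡ-≤ 0≤p m≤n)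

module _ where
  open Data.Integer.Solver.+-*-Solver
  open ℚᵘP.≃-Reasoning

  private
    toℚᵘ-/ : ∀ i m → toℚᵘ (i / suc m) ≃ᵘ mkℚᵘ i m
    toℚᵘ-/ i m = ℚP.toℚᵘ-fromℚᵘ (mkℚᵘ i m)

  [1+m]/1≡1+m/1 : ∀ m → + suc m / 1 ≡ 1ℚ + + m / 1
  [1+m]/1≡1+m/1 m = ℚP.toℚᵘ-injective (begin
    toℚᵘ (+ suc m / 1)           ≈⟨ toℚᵘ-/ (+ suc m) 0 ⟩
    mkℚᵘ (+ suc m) 0             ≈⟨ *≡* (solve 1 (λ m → (con (+ 1) :+ m) :* con (+ 1)
                                          := (con (+ 1) :* con (+ 1) :+ m :* con (+ 1)) :* con (+ 1)) refl (+ m)) ⟩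
    toℚᵘ 1ℚ ℚᵘ.+ mkℚᵘ (+ m) 0    ≈⟨ ℚᵘP.+-congʳ (toℚᵘ 1ℚ) (toℚᵘ-/ (+ m) 0) ⟨
    toℚᵘ 1ℚ ℚᵘ.+ toℚᵘ (+ m / 1)  ≈⟨ ℚP.toℚᵘ-homo-+ 1ℚ (+ m / 1) ⟨
    toℚᵘ (1ℚ + + m / 1)          ∎)

  [1+j]/1*twoOver[1+j]≡2 : ∀ j → (+ suc j / 1) * twoOver (suc j) ≡ 2ℚ
  [1+j]/1*twoOver[1+j]≡2 j = ℚP.toℚᵘ-injective (begin
    toℚᵘ ((+ suc j / 1) * (+ 2 / suc j))          ≈⟨ ℚP.toℚᵘ-homo-* (+ suc j / 1) (+ 2 / suc j) ⟩
    toℚᵘ (+ suc j / 1) ℚᵘ.* toℚᵘ (+ 2 / suc j)    ≈⟨ ℚᵘP.*-cong (toℚᵘ-/ (+ suc j) 0) (toℚᵘ-/ (+ 2) j) ⟩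
    mkℚᵘ (+ suc j) 0 ℚᵘ.* mkℚᵘ (+ 2) j            ≈⟨ *≡* (solve 1 (λ j → ((con (+ 1) :+ j) :* con (+ 2)) :* con (+ 1)
                                                          := con (+ 2) :* (con (+ 1) :* (con (+ 1) :+ j))) refl (+ j)) ⟩
    mkℚᵘ (+ 2) 0                                  ≈⟨ toℚᵘ-/ (+ 2) 0 ⟨
    toℚᵘ 2ℚ                                        ∎)

·≡/1* : ∀ m p → m · p ≡ (+ m / 1) * p
·≡/1* zero    p = sym (ℚP.*-zeroˡ p)
·≡/1* (suc m) p = begin
  p + m · p                    ≡⟨ cong₂ _+_ (sym (ℚP.*-identityˡ p)) (·≡/1* m p) ⟩
  1ℚ * p + (+ m / 1) * p       ≡⟨ ℚP.*-distribʳ-+ p 1ℚ (+ m / 1) ⟨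
  (1ℚ + + m / 1) * p           ≡⟨ cong (_* p) ([1+m]/1≡1+m/1 m) ⟨
  (+ suc m / 1) * p            ∎
  where open Relation.Binary.PropositionalEquality.≡-Reasoning

·-≤⇒≤-twoOver* : ∀ {m p q} → 0 < m → m · p ≤ℚ 2ℚ * q → p ≤ℚ twoOver m * q
·-≤⇒≤-twoOver* {suc j} {p} {q} _ mp≤2q =
  ℚP.*-cancelˡ-≤-pos (+ suc j / 1) {{ℚP.normalize-pos (suc j) 1}} (begin
    (+ suc j / 1) * p                        ≡⟨ ·≡/1* (suc j) p ⟨
    suc j · p                                ≤⟨ mp≤2q ⟩
    2ℚ * q                                   ≡⟨ cong (_* q) ([1+j]/1*twoOver[1+j]≡2 j) ⟨
    (+ suc j / 1) * twoOver (suc j) * q      ≡⟨ ℚP.*-assoc (+ suc j / 1) (twoOver (suc j)) q ⟩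
    (+ suc j / 1) * (twoOver (suc j) * q)    ∎)
  where open ℚP.≤-Reasoning

∑ : List A → (A → ℚ) → ℚ
∑ xs f = sumList (map f xs)

syntax ∑ xs (λ x → e) = ∑[ x ← xs ] e

∑-mono-≤ : ∀ (xs : List A) {f g : A → ℚ} → (∀ {x} → x ∈ₗ xs → f x ≤ℚ g x) → ∑ xs f ≤ℚ ∑ xs g
∑-mono-≤ []       f≤g = ℚP.≤-refl
∑-mono-≤ (x ∷ xs) f≤g = ℚP.+-mono-≤ (f≤g (here refl)) (∑-mono-≤ xs (f≤g ∘ there))

∑-const : ∀ (xs : List A) c → ∑[ _ ← xs ] c ≡ length xs · c
∑-const []       c = refl
∑-const (_ ∷ xs) c = cong (_+_ c) (∑-const xs c)

∑-*ˡ : ∀ (xs : List A) c f → ∑[ x ← xs ] (c * f x) ≡ c * ∑ xs f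
∑-*ˡ []       c f = sym (ℚP.*-zeroʳ c)
∑-*ˡ (x ∷ xs) c f = trans (cong (_+_ (c * f x)) (∑-*ˡ xs c f)) (sym (ℚP.*-distribˡ-+ c (f x) (∑ xs f)))

∑-+ : ∀ (xs : List A) f g → ∑[ x ← xs ] (f x + g x) ≡ ∑ xs f + ∑ xs g
∑-+ []       f g = refl
∑-+ (x ∷ xs) f g = trans (cong (_+_ (f x + g x)) (∑-+ xs f g))
  (solve 4 (λ a b c d → (a :+ b) :+ (c :+ d) := (a :+ c) :+ (b :+ d)) refl (f x) (g x) (∑ xs f) (∑ xs g))
  where open Data.Rational.Solver.+-*-Solver

∑-- : ∀ (xs : List A) f g → ∑ xs f -ℚ ∑ xs g ≡ ∑[ x ← xs ] (f x -ℚ g x)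
∑-- []       f g = refl
∑-- (x ∷ xs) f g = trans
  (solve 4 (λ a b c d → (a :+ b) :- (c :+ d) := (a :- c) :+ (b :- d)) refl (f x) (∑ xs f) (g x) (∑ xs g))
  (cong (_+_ (f x -ℚ g x)) (∑-- xs f g))
  where open Data.Rational.Solver.+-*-Solver

∑-comm : ∀ {B : Set} (xs : List A) (ys : List B) (h : A → B → ℚ) →
         ∑[ x ← xs ] ∑[ y ← ys ] h x y ≡ ∑[ y ← ys ] ∑[ x ← xs ] h x y
∑-comm []       ys h = sym (trans (∑-const ys 0ℚ) (·-zero (length ys)))
  where
  ·-zero : ∀ m → m · 0ℚ ≡ 0ℚ
  ·-zero zero    = refl
  ·-zero (suc m) = cong (_+_ 0ℚ) (·-zero m)
∑-comm (x ∷ xs) ys h = trans (cong (_+_ (∑ ys (h x))) (∑-comm xs ys h)) (sym (∑-+ ys (h x) _))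

∑-≤-single : ∀ (_≟_ : DecidableEquality A) {xs : List A} {f : A → ℚ} {c : A} {B : ℚ} → Unique xs → 0ℚ ≤ℚ B →
             (∀ {x} → x ∈ₗ xs → x ≢ c → f x ≤ℚ 0ℚ) → (c ∈ₗ xs → f c ≤ℚ B) → ∑ xs f ≤ℚ B
∑-≤-single _≟_ {[]} [] 0≤B _ _ = 0≤B
∑-≤-single _≟_ {x ∷ xs} {c = c} {B} (x∉xs ∷ unique) 0≤B off-c at-c with x ≟ c
... | yes refl = subst (_ ≤ℚ_) (ℚP.+-identityʳ B) (ℚP.+-mono-≤ (at-c (here refl))
                   (∑-≤-single _≟_ unique ℚP.≤-refl (off-c ∘ there) (λ x∈xs → ⊥-elim (All.lookup x∉xs x∈xs refl))))
... | no  x≢c  = subst (_ ≤ℚ_) (ℚP.+-identityˡ B) (ℚP.+-mono-≤ (off-c (here refl) x≢c)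
                   (∑-≤-single _≟_ unique 0≤B (off-c ∘ there) (at-c ∘ there)))

minList-≤ : ∀ {qs q} → q ∈ₗ qs → minList qs ≤ℚ q
minList-≤ {p ∷ ps} {q} q∈qs = foldr-preservesᵒ {P = _≤ℚ q}
  (λ x y → [ ℚP.≤-trans (ℚP.p⊓q≤p x y) , ℚP.≤-trans (ℚP.p⊓q≤q x y) ]) p ps (head-or-tail q∈qs)
  where
  head-or-tail : q ∈ₗ p ∷ ps → p ≤ℚ q ⊎ Any (_≤ℚ q) ps
  head-or-tail (here refl)  = inj₁ ℚP.≤-refl
  head-or-tail (there q∈ps) = inj₂ (Any.map (λ { refl → ℚP.≤-refl }) q∈ps)

minList-∈ : ∀ {qs q} → q ∈ₗ qs → minList qs ∈ₗ qs
minList-∈ {p ∷ ps} _ with foldr-selective ℚP.⊓-sel p ps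
... | inj₁ min≡p   = here min≡p
... | inj₂ min∈ps  = there min∈ps

∈-elems⁺ : ∀ {p : Subset n} {x} → x ∈ p → x ∈ₗ elems p
∈-elems⁺ {p = inside  ∷ p} here        = here refl
∈-elems⁺ {p = outside ∷ p} (there x∈p) = ∈-map⁺ suc (∈-elems⁺ x∈p)
∈-elems⁺ {p = inside  ∷ p} (there x∈p) = there (∈-map⁺ suc (∈-elems⁺ x∈p))

∈-elems⁻ : ∀ {p : Subset n} {x} → x ∈ₗ elems p → x ∈ p
∈-elems⁻ {p = outside ∷ p} x∈ with ∈-map⁻ suc x∈
... | _ , y∈ , refl = there (∈-elems⁻ y∈)
∈-elems⁻ {p = inside ∷ p} (here refl) = here
∈-elems⁻ {p = inside ∷ p} (there x∈) with ∈-map⁻ suc x∈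
... | _ , y∈ , refl = there (∈-elems⁻ y∈)

length-elems : ∀ (p : Subset n) → length (elems p) ≡ ∣ p ∣
length-elems []            = refl
length-elems (outside ∷ p) = trans (length-map suc (elems p)) (length-elems p)
length-elems (inside  ∷ p) = cong suc (trans (length-map suc (elems p)) (length-elems p))

elems-unique : ∀ (p : Subset n) → Unique (elems p)
elems-unique []            = []
elems-unique (outside ∷ p) = UniqueP.map⁺ FinP.suc-injective (elems-unique p)
elems-unique (inside  ∷ p) =
  AllP.map⁺ (All.universal (λ _ ()) (elems p)) ∷ UniqueP.map⁺ FinP.suc-injective (elems-unique p)

∈-allSubsets : ∀ (p : Subset n) → p ∈ₗ allSubsets n
∈-allSubsets []                      = here refl
∈-allSubsets (outside ∷ p)           = ∈-++⁺ˡ (∈-map⁺ (outside ∷_) (∈-allSubsets p))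
∈-allSubsets {suc n} (inside ∷ p)    =
  ∈-++⁺ʳ (map (outside ∷_) (allSubsets n)) (∈-map⁺ (inside ∷_) (∈-allSubsets p))

subsetOfSize : ∀ {k} → k ≤ n → ∃ λ (p : Subset n) → ∣ p ∣ ≡ k
subsetOfSize {n}     {zero}  _         = ⊥ , ∣⊥∣≡0 n
subsetOfSize {suc n} {suc k} (s≤s k≤n) = Product.map (inside ∷_) (cong suc) (subsetOfSize k≤n)

∣p∣>0⇒Nonempty : ∀ {p : Subset n} → 0 < ∣ p ∣ → Nonempty p
∣p∣>0⇒Nonempty {p = inside  ∷ p} _     = zero , here
∣p∣>0⇒Nonempty {p = outside ∷ p} ∣p∣>0 = Product.map suc there (∣p∣>0⇒Nonempty ∣p∣>0)

x∈p⇒suc∣p-x∣≡∣p∣ : ∀ {p : Subset n} {x} → x ∈ p → suc ∣ p - x ∣ ≡ ∣ p ∣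
x∈p⇒suc∣p-x∣≡∣p∣ {p = inside  ∷ p} here        = cong (suc ∘ ∣_∣) (p─⊥≡p p)
x∈p⇒suc∣p-x∣≡∣p∣ {p = outside ∷ p} (there x∈p) = x∈p⇒suc∣p-x∣≡∣p∣ x∈p
x∈p⇒suc∣p-x∣≡∣p∣ {p = inside  ∷ p} (there x∈p) = cong suc (x∈p⇒suc∣p-x∣≡∣p∣ x∈p)

x∈p─q⇒x∉q : ∀ (p q : Subset n) {x} → x ∈ p ─ q → x ∉ q
x∈p─q⇒x∉q (inside ∷ p) (outside ∷ q) here           ()
x∈p─q⇒x∉q (_ ∷ p)      (_ ∷ q)       (there x∈p─q) (there x∈q) = x∈p─q⇒x∉q p q x∈p─q x∈q

∣p∪q∣≤∣p∣+∣q∣ : ∀ (p q : Subset n) → ∣ p ∪ q ∣ ≤ ∣ p ∣ +ℕ ∣ q ∣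
∣p∪q∣≤∣p∣+∣q∣ []            []            = z≤n
∣p∪q∣≤∣p∣+∣q∣ (outside ∷ p) (outside ∷ q) = ∣p∪q∣≤∣p∣+∣q∣ p q
∣p∪q∣≤∣p∣+∣q∣ (outside ∷ p) (inside  ∷ q) =
  subst (suc ∣ p ∪ q ∣ ≤_) (sym (ℕP.+-suc ∣ p ∣ ∣ q ∣)) (s≤s (∣p∪q∣≤∣p∣+∣q∣ p q))
∣p∪q∣≤∣p∣+∣q∣ (inside  ∷ p) (outside ∷ q) = s≤s (∣p∪q∣≤∣p∣+∣q∣ p q)
∣p∪q∣≤∣p∣+∣q∣ (inside  ∷ p) (inside  ∷ q) =
  s≤s (ℕP.≤-trans (∣p∪q∣≤∣p∣+∣q∣ p q) (ℕP.+-monoʳ-≤ ∣ p ∣ (ℕP.n≤1+n ∣ q ∣)))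

∣p∣≤∣q∣+∣p─q∣ : ∀ (p q : Subset n) → ∣ p ∣ ≤ ∣ q ∣ +ℕ ∣ p ─ q ∣
∣p∣≤∣q∣+∣p─q∣ p q = ℕP.≤-trans (p⊆q⇒∣p∣≤∣q∣ p⊆q∪[p─q]) (∣p∪q∣≤∣p∣+∣q∣ q (p ─ q))
  where
  p⊆q∪[p─q] : p ⊆ q ∪ (p ─ q)
  p⊆q∪[p─q] {x} x∈p with x ∈? q
  ... | yes x∈q = x∈p∪q⁺ (inj₁ x∈q)
  ... | no  x∉q = x∈p∪q⁺ (inj₂ (x∈p∧x∉q⇒x∈p─q x∈p x∉q))

image : (A → Fin n) → List A → Subset n
image f xs = ⋃ (map (λ x → ⁅ f x ⁆) xs)

∣image∣≤length : ∀ (f : A → Fin n) xs → ∣ image f xs ∣ ≤ length xs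
∣image∣≤length {n = n} f []  = ℕP.≤-reflexive (∣⊥∣≡0 n)
∣image∣≤length f (x ∷ xs) = begin
  ∣ ⁅ f x ⁆ ∪ image f xs ∣          ≤⟨ ∣p∪q∣≤∣p∣+∣q∣ ⁅ f x ⁆ (image f xs) ⟩
  ∣ ⁅ f x ⁆ ∣ +ℕ ∣ image f xs ∣     ≡⟨ cong (_+ℕ ∣ image f xs ∣) (∣⁅x⁆∣≡1 (f x)) ⟩
  suc ∣ image f xs ∣                ≤⟨ s≤s (∣image∣≤length f xs) ⟩
  suc (length xs)                   ∎
  where open ℕP.≤-Reasoning

∈-image⁺ : ∀ (f : A → Fin n) {xs x} → x ∈ₗ xs → f x ∈ image f xs
∈-image⁺ f (here refl)  = x∈p∪q⁺ (inj₁ (x∈⁅x⁆ (f _)))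
∈-image⁺ f (there x∈xs) = x∈p∪q⁺ (inj₂ (∈-image⁺ f x∈xs))

mutual
  -- OPT filters through a where-bound helper, which cannot be named; this meta is solved
  -- to it by the equation below once the surrounding functions are abstracted.
  sizeFilter : (Fin n → Fin n → ℚ) → (Fin n → ℚ) → ℕ → List (Subset n) → List (Subset n)
  sizeFilter = _

  OPT-unfold : ∀ (d : Fin n → Fin n → ℚ) w k → OPT d w k ≡ minList (map (cost d w) (sizeFilter d w k (allSubsets n)))
  OPT-unfold {n} d w k with minList | map (cost d w) | allSubsets n
  ... | _ | _ | _ = refl

module _ (d : Fin n → Fin n → ℚ) (w : Fin n → ℚ) (k : ℕ) where

  ∈-sizeFilter⁻ : ∀ {S} Ss → S ∈ₗ sizeFilter d w k Ss → ∣ S ∣ ≡ k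
  ∈-sizeFilter⁻ (S′ ∷ Ss) S∈ with ∣ S′ ∣ ≡ᵇ k in eq | S∈
  ... | true  | here refl = ℕP.≡ᵇ⇒≡ ∣ S′ ∣ k (subst T (sym eq) _)
  ... | true  | there S∈′ = ∈-sizeFilter⁻ Ss S∈′
  ... | false | S∈′       = ∈-sizeFilter⁻ Ss S∈′

  ∈-sizeFilter⁺ : ∀ {S} Ss → S ∈ₗ Ss → ∣ S ∣ ≡ k → S ∈ₗ sizeFilter d w k Ss
  ∈-sizeFilter⁺ (S′ ∷ Ss) S∈ ∣S∣≡k with ∣ S′ ∣ ≡ᵇ k in eq | S∈
  ... | true  | here refl = here refl
  ... | true  | there S∈′ = there (∈-sizeFilter⁺ Ss S∈′ ∣S∣≡k)
  ... | false | here refl = ⊥-elim (subst T eq (ℕP.≡⇒≡ᵇ ∣ S′ ∣ k ∣S∣≡k))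
  ... | false | there S∈′ = ∈-sizeFilter⁺ Ss S∈′ ∣S∣≡k

  OPT-attained : k ≤ n → ∃ λ O → ∣ O ∣ ≡ k × cost d w O ≡ OPT d w k
  OPT-attained k≤n =
    let S , ∣S∣≡k        = subsetOfSize k≤n
        S∈               = ∈-sizeFilter⁺ (allSubsets n) (∈-allSubsets S) ∣S∣≡k
        O , O∈ , OPT≡cost = ∈-map⁻ (cost d w) (minList-∈ (∈-map⁺ (cost d w) S∈))
    in O , ∈-sizeFilter⁻ (allSubsets n) O∈ , sym (trans (OPT-unfold d w k) OPT≡cost)

-- Distances to sets

module Distances (d : Fin n → Fin n → ℚ) where

  distToSet-≤ : ∀ {x y S} → y ∈ S → distToSet d x S ≤ℚ d x y
  distToSet-≤ y∈S = minList-≤ (∈-map⁺ _ (∈-elems⁺ y∈S))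

  nearest : ∀ x {S} → Nonempty S → ∃ λ c → c ∈ S × distToSet d x S ≡ d x c
  nearest x (y , y∈S) with ∈-map⁻ (d x) (minList-∈ (∈-map⁺ (d x) (∈-elems⁺ y∈S)))
  ... | c , c∈ , dist≡ = c , ∈-elems⁻ c∈ , dist≡

  distToSet-antitone : ∀ x {S S′} → S′ ⊆ S → Nonempty S′ → distToSet d x S ≤ℚ distToSet d x S′
  distToSet-antitone x S′⊆S S′≠∅ with nearest x S′≠∅
  ... | c , c∈S′ , dist≡ = subst (distToSet d x _ ≤ℚ_) (sym dist≡) (distToSet-≤ (S′⊆S c∈S′))

  cost-antitone : ∀ {w} → (∀ x → 0ℚ ≤ℚ w x) → ∀ {S S′} → S′ ⊆ S → Nonempty S′ → cost d w S ≤ℚ cost d w S′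
  cost-antitone w≥0 S′⊆S S′≠∅ =
    ∑-mono-≤ (allPoints n) (λ {x} _ → *-monoˡ-≤-≥0 (w≥0 x) (distToSet-antitone x S′⊆S S′≠∅))

  module _ (metric : IsMetric d) where
    open IsMetric metric

    distToSet-nonNeg : ∀ x {S} → Nonempty S → 0ℚ ≤ℚ distToSet d x S
    distToSet-nonNeg x S≠∅ with nearest x S≠∅
    ... | c , _ , dist≡ = subst (0ℚ ≤ℚ_) (sym dist≡) (nonneg x c)

    detour : ∀ x o c p → d o p ≤ℚ d o c → d x p ≤ℚ d x c + 2ℚ * d x o
    detour x o c p op≤oc = begin
      d x p                      ≤⟨ triangle x o p ⟩
      d x o + d o p              ≤⟨ ℚP.+-monoʳ-≤ (d x o) op≤oc ⟩
      d x o + d o c              ≤⟨ ℚP.+-monoʳ-≤ (d x o) (triangle o x c) ⟩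
      d x o + (d o x + d x c)    ≡⟨ cong (λ t → d x o + (t + d x c)) (symm o x) ⟩
      d x o + (d x o + d x c)    ≡⟨ solve 2 (λ a b → a :+ (a :+ b) := b :+ con 2ℚ :* a) refl (d x o) (d x c) ⟩
      d x c + 2ℚ * d x o         ∎
      where
      open ℚP.≤-Reasoning
      open Data.Rational.Solver.+-*-Solver

-- One step of reverse greedy

module _ {d : Fin n → Fin n → ℚ} (metric : IsMetric d) {w : Fin n → ℚ} (w≥0 : ∀ x → 0ℚ ≤ℚ w x) where

  open Distances d

  module Snapping (T : Subset n) (T≠∅ : Nonempty T) (O : Subset n) (O≠∅ : Nonempty O) where

    snap : Fin n → Fin n
    snap o = proj₁ (nearest o T≠∅)

    snap-∈ : ∀ o → snap o ∈ T
    snap-∈ o = proj₁ (proj₂ (nearest o T≠∅))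

    snap-nearest : ∀ o {c} → c ∈ T → d o (snap o) ≤ℚ d o c
    snap-nearest o c∈T = subst (_≤ℚ _) (proj₂ (proj₂ (nearest o T≠∅))) (distToSet-≤ c∈T)

    Unclaimed : Subset n
    Unclaimed = T ─ image snap (elems O)

    ∣T∣∸∣O∣≤∣Unclaimed∣ : ∣ T ∣ ∸ ∣ O ∣ ≤ length (elems Unclaimed)
    ∣T∣∸∣O∣≤∣Unclaimed∣ = ℕP.m≤n+o⇒m∸n≤o ∣ T ∣ ∣ O ∣ (begin
      ∣ T ∣                                      ≤⟨ ∣p∣≤∣q∣+∣p─q∣ T (image snap (elems O)) ⟩
      ∣ image snap (elems O) ∣ +ℕ ∣ Unclaimed ∣   ≤⟨ ℕP.+-monoˡ-≤ ∣ Unclaimed ∣ (∣image∣≤length snap (elems O)) ⟩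
      length (elems O) +ℕ ∣ Unclaimed ∣           ≡⟨ cong₂ _+ℕ_ (length-elems O) (sym (length-elems Unclaimed)) ⟩
      ∣ O ∣ +ℕ length (elems Unclaimed)           ∎)
      where open ℕP.≤-Reasoning

    -- x is served instead by the snap of its optimal centre, which differs from c as c is unclaimed.
    distToSet-without-unclaimed : ∀ x {c} → c ∈ Unclaimed → distToSet d x T ≡ d x c →
                                  distToSet d x (T - c) ≤ℚ distToSet d x T + 2ℚ * distToSet d x O
    distToSet-without-unclaimed x {c} c∈U dist≡ with nearest x O≠∅
    ... | o , o∈O , distO≡ = begin
      distToSet d x (T - c)                     ≤⟨ distToSet-≤ (x∈p∧x≢y⇒x∈p-y (snap-∈ o) snap[o]≢c) ⟩
      d x (snap o)                              ≤⟨ detour metric x o c (snap o) (snap-nearest o (p─q⊆p T _ c∈U)) ⟩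
      d x c + 2ℚ * d x o                        ≡⟨ cong₂ (λ a b → a + 2ℚ * b) dist≡ distO≡ ⟨
      distToSet d x T + 2ℚ * distToSet d x O    ∎
      where
      open ℚP.≤-Reasoning
      snap[o]≢c : snap o ≢ c
      snap[o]≢c snap[o]≡c = x∈p─q⇒x∉q T (image snap (elems O)) c∈U
        (subst (_∈ image snap (elems O)) snap[o]≡c (∈-image⁺ snap (∈-elems⁺ o∈O)))

    marginal : Fin n → Fin n → ℚ
    marginal x z = w x * distToSet d x (T - z) -ℚ w x * distToSet d x T

    ∑-marginal-≤ : ∀ x → ∑[ z ← elems Unclaimed ] marginal x z ≤ℚ 2ℚ * (w x * distToSet d x O)
    ∑-marginal-≤ x with nearest x T≠∅
    ... | c , c∈T , dist≡ = ∑-≤-single FinP._≟_ (elems-unique Unclaimed) 0≤bound away-from-c at-c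
      where
      0≤bound : 0ℚ ≤ℚ 2ℚ * (w x * distToSet d x O)
      0≤bound = *-nonNeg (ℚP.nonNegative⁻¹ 2ℚ) (*-nonNeg (w≥0 x) (distToSet-nonNeg metric x O≠∅))

      away-from-c : ∀ {z} → z ∈ₗ elems Unclaimed → z ≢ c → marginal x z ≤ℚ 0ℚ
      away-from-c _ z≢c = p≤q⇒p-q≤0 (*-monoˡ-≤-≥0 (w≥0 x)
        (subst (distToSet d x (T - _) ≤ℚ_) (sym dist≡) (distToSet-≤ (x∈p∧x≢y⇒x∈p-y c∈T (z≢c ∘ sym)))))

      at-c : c ∈ₗ elems Unclaimed → marginal x c ≤ℚ 2ℚ * (w x * distToSet d x O)
      at-c c∈ = begin
        w x * distToSet d x (T - c) -ℚ w x * distToSet d x T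
          ≤⟨ ℚP.+-monoˡ-≤ (- (w x * distToSet d x T))
               (*-monoˡ-≤-≥0 (w≥0 x) (distToSet-without-unclaimed x (∈-elems⁻ c∈) dist≡)) ⟩
        w x * (distToSet d x T + 2ℚ * distToSet d x O) -ℚ w x * distToSet d x T
          ≡⟨ solve 3 (λ W a b → W :* (a :+ con 2ℚ :* b) :- W :* a := con 2ℚ :* (W :* b)) refl
               (w x) (distToSet d x T) (distToSet d x O) ⟩
        2ℚ * (w x * distToSet d x O) ∎
        where
        open ℚP.≤-Reasoning
        open Data.Rational.Solver.+-*-Solver

    ∑-removal-cost-≤ : ∑[ z ← elems Unclaimed ] (cost d w (T - z) -ℚ cost d w T) ≤ℚ 2ℚ * cost d w O
    ∑-removal-cost-≤ = begin
      ∑[ z ← elems Unclaimed ] (cost d w (T - z) -ℚ cost d w T)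
        ≡⟨ cong sumList (map-cong (λ z → ∑-- (allPoints n) _ _) (elems Unclaimed)) ⟩
      ∑[ z ← elems Unclaimed ] ∑[ x ← allPoints n ] marginal x z
        ≡⟨ ∑-comm (elems Unclaimed) (allPoints n) (λ z x → marginal x z) ⟩
      ∑[ x ← allPoints n ] ∑[ z ← elems Unclaimed ] marginal x z
        ≤⟨ ∑-mono-≤ (allPoints n) (λ _ → ∑-marginal-≤ _) ⟩
      ∑[ x ← allPoints n ] (2ℚ * (w x * distToSet d x O))
        ≡⟨ ∑-*ˡ (allPoints n) 2ℚ _ ⟩
      2ℚ * cost d w O ∎
      where open ℚP.≤-Reasoning

  greedy-step-bound : ∀ (T : Subset n) {y} → y ∈ T →
                      (∀ z → z ∈ T → cost d w (T - y) ≤ℚ cost d w (T - z)) →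
                      ∀ (O : Subset n) → 0 < ∣ O ∣ → ∣ O ∣ < ∣ T ∣ →
                      cost d w (T - y) -ℚ cost d w T ≤ℚ twoOver (∣ T ∣ ∸ ∣ O ∣) * cost d w O
  greedy-step-bound T {y} y∈T y-best O 0<∣O∣ ∣O∣<∣T∣ =
    ·-≤⇒≤-twoOver* (ℕP.m<n⇒0<n∸m ∣O∣<∣T∣) (begin
      (∣ T ∣ ∸ ∣ O ∣) · Δ                ≤⟨ ·-monoˡ-≤ 0≤Δ ∣T∣∸∣O∣≤∣Unclaimed∣ ⟩
      length (elems Unclaimed) · Δ       ≡⟨ ∑-const (elems Unclaimed) Δ ⟨
      ∑[ _ ← elems Unclaimed ] Δ         ≤⟨ ∑-mono-≤ (elems Unclaimed) Δ≤removal-cost ⟩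
      ∑[ z ← elems Unclaimed ] (cost d w (T - z) -ℚ cost d w T)
                                         ≤⟨ ∑-removal-cost-≤ ⟩
      2ℚ * cost d w O                    ∎)
    where
    open Snapping T (y , y∈T) O (∣p∣>0⇒Nonempty 0<∣O∣)
    open ℚP.≤-Reasoning

    Δ : ℚ
    Δ = cost d w (T - y) -ℚ cost d w T

    0<∣T-y∣ : 0 < ∣ T - y ∣
    0<∣T-y∣ = ℕP.<-≤-trans 0<∣O∣ (s≤s⁻¹ (subst (∣ O ∣ <_) (sym (x∈p⇒suc∣p-x∣≡∣p∣ y∈T)) ∣O∣<∣T∣))

    0≤Δ : 0ℚ ≤ℚ Δ
    0≤Δ = p≤q⇒0≤q-p (cost-antitone w≥0 (p─q⊆p T ⁅ y ⁆) (∣p∣>0⇒Nonempty 0<∣T-y∣))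

    Δ≤removal-cost : ∀ {z} → z ∈ₗ elems Unclaimed → Δ ≤ℚ cost d w (T - z) -ℚ cost d w T
    Δ≤removal-cost z∈ = ℚP.+-monoˡ-≤ (- cost d w T) (y-best _ (p─q⊆p T _ (∈-elems⁻ z∈)))

-- The reverse greedy chain

removal-chain-card : ∀ (S : ℕ → Subset n) {lo hi} →
                     (∀ i → lo < i → i ≤ hi → ∃ λ y → y ∈ S i × S (pred i) ≡ S i - y) →
                     ∣ S hi ∣ ≡ hi → ∀ i → lo ≤ i → i ≤ hi → ∣ S i ∣ ≡ i
removal-chain-card S {lo} {hi} removes-one ∣S[hi]∣≡hi i lo≤i i≤hi = go (hi ∸ i) i lo≤i (ℕP.m+[n∸m]≡n i≤hi)
  where
  go : ∀ t i → lo ≤ i → i +ℕ t ≡ hi → ∣ S i ∣ ≡ i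
  go zero i _ i+0≡hi = subst (λ j → ∣ S j ∣ ≡ j) (trans (sym i+0≡hi) (ℕP.+-identityʳ i)) ∣S[hi]∣≡hi
  go (suc t) i lo≤i i+[1+t]≡hi =
    let y , y∈ , S[i]≡ = removes-one (suc i) (s≤s lo≤i) (subst (suc i ≤_) [1+i]+t≡hi (ℕP.m≤m+n (suc i) t))
    in ℕP.suc-injective (begin
      suc ∣ S i ∣              ≡⟨ cong (suc ∘ ∣_∣) S[i]≡ ⟩
      suc ∣ S (suc i) - y ∣    ≡⟨ x∈p⇒suc∣p-x∣≡∣p∣ y∈ ⟩
      ∣ S (suc i) ∣            ≡⟨ go t (suc i) (ℕP.m≤n⇒m≤1+n lo≤i) [1+i]+t≡hi ⟩
      suc i                    ∎)
    where
    open Relation.Binary.PropositionalEquality.≡-Reasoning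
    [1+i]+t≡hi : suc i +ℕ t ≡ hi
    [1+i]+t≡hi = trans (sym (ℕP.+-suc i t)) i+[1+t]≡hi

lemma4p2 : ∀ {n : ℕ} (d : Fin n → Fin n → ℚ) (w : Fin n → ℚ)
    → IsMetric d → (∀ x → 0ℚ ≤ℚ w x)
    → (X : Subset n) (k k' : ℕ) → 1 ≤ k → k ≤ k' → k' ≤ ∣ X ∣
    → (S : ℕ → Subset n)
    → S ∣ X ∣ ≡ X
    → (∀ i → k' < i → i ≤ ∣ X ∣ →
    Σ (Fin n) λ y → (y ∈ S i) × (S (pred i) ≡ (S i - y))
    × (∀ z → z ∈ S i → cost d w (S i - y) ≤ℚ cost d w (S i - z)))
    → ∀ i → k' < i → i ≤ ∣ X ∣
    → (cost d w (S (pred i)) -ℚ cost d w (S i)) ≤ℚ (twoOver (i ∸ k) * OPT d w k)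
lemma4p2 d w metric w≥0 X k k' 1≤k k≤k' k'≤∣X∣ S S∣X∣≡X step i k'<i i≤∣X∣
  with step i k'<i i≤∣X∣ | OPT-attained d w k (ℕP.≤-trans k≤k' (ℕP.≤-trans k'≤∣X∣ (∣p∣≤n X)))
... | y , y∈Sᵢ , Sᵢ₋₁≡Sᵢ-y , y-best | O , ∣O∣≡k , cost[O]≡OPT = begin
  cost d w (S (pred i)) -ℚ cost d w (S i)   ≡⟨ cong (λ T → cost d w T -ℚ cost d w (S i)) Sᵢ₋₁≡Sᵢ-y ⟩
  cost d w (S i - y) -ℚ cost d w (S i)      ≤⟨ greedy-step-bound metric w≥0 (S i) y∈Sᵢ y-best O 0<∣O∣ ∣O∣<∣Sᵢ∣ ⟩
  twoOver (∣ S i ∣ ∸ ∣ O ∣) * cost d w O    ≡⟨ cong₂ (λ m c → twoOver m * c) (cong₂ _∸_ ∣Sᵢ∣≡i ∣O∣≡k) cost[O]≡OPT ⟩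
  twoOver (i ∸ k) * OPT d w k               ∎
  where
  open ℚP.≤-Reasoning

  ∣Sᵢ∣≡i : ∣ S i ∣ ≡ i
  ∣Sᵢ∣≡i = removal-chain-card S (λ j k'<j j≤∣X∣ → map₂ (map₂ proj₁) (step j k'<j j≤∣X∣))
             (cong ∣_∣ S∣X∣≡X) i (ℕP.<⇒≤ k'<i) i≤∣X∣

  0<∣O∣ : 0 < ∣ O ∣
  0<∣O∣ = subst (0 <_) (sym ∣O∣≡k) 1≤k

  ∣O∣<∣Sᵢ∣ : ∣ O ∣ < ∣ S i ∣
  ∣O∣<∣Sᵢ∣ = subst₂ _<_ (sym ∣O∣≡k) (sym ∣Sᵢ∣≡i) (ℕP.≤-<-trans k≤k' k'<i)
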